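{- Let $n\ge 1$ and, for each $k\ge 1$, let $D^*_k$ be the operator on $\mathbb{R}[x_1,\ldots,x_n]$ given by $$D^*_k=\sum_{i=1}^n a_{i,k}\,x_i^{k+1}\partial_i+b_{i,k}\,x_i^k,$$ with real parameters $a_{i,k},b_{i,k}$. Suppose that for all $k,j\ge 1$ there is a constant $c_{k,j}$ with $[D^*_k,D^*_j]=c_{k,j}\,D^*_{k+j}$. Then for every $d\ge 1$, the linear span of the operators $\{D^*_\lambda\}_{\lambda\vdash d}$ (indexed by partitions $\lambda$ of $d$) equals the linear span of the operators $\{D^*_\alpha\}_{\alpha\models d}$ (indexed by compositions $\alpha$ of $d$).
   Context: $\partial_i$ denotes $\partial/\partial x_i$, $x_i^k$ acts by multiplication, and $[A,B]=AB-BA$. For a composition $\alpha=(\alpha_1,\ldots,\alpha_m)$ (a finite sequence of positive integers), $|\alpha|=\alpha_1+\cdots+\alpha_m$, $\alpha\models d$ means $|\alpha|=d$, and $D^*_\alpha:=D^*_{\alpha_1}D^*_{\alpha_2}\cdots D^*_{\alpha_m}$. A partition of $d$ is a composition of $d$ whose parts are weakly decreasing, written $\lambda\vdash d$. -}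

module Defs where

open import Level using (Level; _⊔_)
open import Algebra.Bundles using (CommutativeRing)
open import Data.Nat as ℕ using (ℕ; zero; suc; _≤_; _≥_)
open import Data.Fin using (Fin)
open import Data.Vec as Vec using (Vec; lookup; updateAt)
import Data.Vec.Properties as VecP
open import Data.List as List using (List; []; _∷_; _++_; concatMap; foldr; allFin)
open import Data.List.Relation.Unary.All using (All)
open import Data.List.Relation.Unary.Linked using (Linked)
open import Data.Product using (_×_; _,_; Σ; ∃)
open import Relation.Nullary using (does)
open import Relation.Binary.PropositionalEquality using (_≡_)
open import Data.Nat.ListAction using (sum)
open import Data.Bool using (if_then_else_)

-- Polynomial differential operators on R[x_1,…,x_n], over a commutative
-- ring R (the paper uses R = ℝ, which agda-stdlib does not provide).
module Ops {c ℓ : Level} (R : CommutativeRing c ℓ) (n : ℕ) where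
  open CommutativeRing R renaming (Carrier to K)

  Mon : Set
  Mon = Vec ℕ n

  -- a polynomial is a finite formal sum of terms  coefficient · x^e
  Poly : Set c
  Poly = List (K × Mon)

  fromℕ : ℕ → K
  fromℕ zero    = 0#
  fromℕ (suc m) = 1# + fromℕ m

  coeff : Poly → Mon → K
  coeff []             e = 0#
  coeff ((a , f) ∷ p) e =
    if does (VecP.≡-dec ℕ._≟_ f e) then a + coeff p e else coeff p e

  _≈P_ : Poly → Poly → Set ℓ
  p ≈P q = ∀ e → coeff p e ≈ coeff q e

  Op : Set c
  Op = Poly → Poly

  _≈Op_ : Op → Op → Set (c ⊔ ℓ)
  S ≈Op T = ∀ p → S p ≈P T p

  idOp : Op
  idOp p = p

  zeroOp : Op
  zeroOp _ = []

  _∘Op_ : Op → Op → Op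
  (S ∘Op T) p = S (T p)

  _⊕_ : Op → Op → Op
  (S ⊕ T) p = S p ++ T p

  _•_ : K → Op → Op
  (a • T) p = List.map (λ { (b , e) → (a * b , e) }) (T p)

  [_,_] : Op → Op → Op
  [ S , T ] = (S ∘Op T) ⊕ ((- 1#) • (T ∘Op S))

  mulX : Fin n → ℕ → Op
  mulX i k = List.map (λ { (a , e) → (a , updateAt e i (ℕ._+ k)) })

  ∂ : Fin n → Op
  ∂ i = List.map (λ { (a , e) → (a * fromℕ (lookup e i) , updateAt e i (ℕ._∸ 1)) })

  ΣOp : List Op → Op
  ΣOp = foldr _⊕_ zeroOp

  -- D*_k = Σ_i a_{i,k} x_i^{k+1} ∂_i + b_{i,k} x_i^k
  -- (parameters a, b : ℕ → Fin n → K, only used at k ≥ 1)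
  Dstar : (ℕ → Fin n → K) → (ℕ → Fin n → K) → ℕ → Op
  Dstar a b k = ΣOp (List.map (λ i → (a k i • (mulX i (suc k) ∘Op ∂ i)) ⊕ (b k i • mulX i k)) (allFin n))

  DstarSeq : (ℕ → Fin n → K) → (ℕ → Fin n → K) → List ℕ → Op
  DstarSeq a b α = foldr (λ k T → Dstar a b k ∘Op T) idOp α

  InSpan : (ℕ → Fin n → K) → (ℕ → Fin n → K) → (List ℕ → Set) → Op → Set (c ⊔ ℓ)
  InSpan a b P T =
    Σ (List (K × List ℕ)) λ cs →
      All (λ { (_ , α) → P α }) cs ×
      (T ≈Op ΣOp (List.map (λ { (γ , α) → γ • DstarSeq a b α }) cs))

IsComposition : ℕ → List ℕ → Set
IsComposition d α = All (λ k → 1 ≤ k) α × sum α ≡ d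

IsPartition : ℕ → List ℕ → Set
IsPartition d α = IsComposition d α × Linked _≥_ α

module Submission where

open import Defs
open import Level using (Level; _⊔_)
open import Algebra.Bundles using (CommutativeRing)
open import Data.Nat using (ℕ; zero; suc; _≤_; _<_; _≥_; _+_; _∸_; _≤?_)
import Data.Nat.Properties as ℕ
open import Data.Nat.Induction using (<-wellFounded)
open import Data.Nat.ListAction using (sum)
open import Data.Nat.ListAction.Properties using (sum-++)
open import Data.Fin using (Fin)
open import Data.Vec using (Vec; lookup; updateAt)
import Data.Vec.Properties as Vec
open import Data.List using (List; []; _∷_; _++_; map; allFin)
import Data.List.Properties as List
open import Data.List.Relation.Unary.All as All using (All; []; _∷_)
import Data.List.Relation.Unary.All.Properties as All
open import Data.List.Relation.Unary.Linked using (Linked; []; [-]; _∷_)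
open import Data.Product using (Σ; Σ-syntax; _×_; _,_; proj₁; proj₂)
open import Data.Sum using (_⊎_; inj₁; inj₂)
open import Function using (_∘_; _⇔_; mk⇔; Equivalence)
open import Induction.WellFounded using (Acc; acc)
open import Relation.Binary using (Setoid)
import Relation.Binary.Reasoning.Setoid as Reasoning
open import Relation.Nullary using (yes; no; contradiction)
open import Relation.Binary.PropositionalEquality as ≡ using (_≡_; _≢_)

open import Algebra.Properties.CommutativeSemigroup ℕ.+-commutativeSemigroup
  using () renaming (x∙yz≈y∙xz to +-left-comm)

-- If a composition α has an adjacent ascent k < j, the hypothesis on commutators gives
--   D*_α = D*_α′ + c_{k,j} D*_α″,
-- where α′ swaps k and j and α″ merges them into k + j; both are again compositions of |α|. Both moves
-- lower Σᵢ (i − 1) αᵢ, so by well-founded induction every D*_α, α ⊨ d, is a combination of D*_λ with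
-- λ ⊢ d. The relation [D*_k, D*_j] = c D*_{k+j} is applied inside a longer product D*_β (⋯), so the
-- argument rests on every D*_k being linear on the (list-represented) polynomials.

-- positionWeight α = Σᵢ (i − 1) αᵢ
positionWeight : List ℕ → ℕ
positionWeight []      = 0
positionWeight (_ ∷ α) = sum α + positionWeight α

record Ascent (α : List ℕ) : Set where
  constructor ascent
  field
    prefix      : List ℕ
    small large : ℕ
    suffix      : List ℕ
    small<large : small < large
    split       : α ≡ prefix ++ small ∷ large ∷ suffix

weaklyDecreasing⊎ascent : ∀ α → Linked _≥_ α ⊎ Ascent α
weaklyDecreasing⊎ascent []          = inj₁ []
weaklyDecreasing⊎ascent (x ∷ [])    = inj₁ [-]
weaklyDecreasing⊎ascent (x ∷ y ∷ α) with y ≤? x | weaklyDecreasing⊎ascent (y ∷ α)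
... | no y≰x  | _       = inj₂ (ascent [] x y α (ℕ.≰⇒> y≰x) ≡.refl)
... | yes y≤x | inj₁ ≥α = inj₁ (y≤x ∷ ≥α)
... | yes _   | inj₂ (ascent β k j δ k<j eq) =
  inj₂ (ascent (x ∷ β) k j δ k<j (≡.cong (x ∷_) eq))

sum-++-cong : ∀ β {α α′} → sum α ≡ sum α′ → sum (β ++ α) ≡ sum (β ++ α′)
sum-++-cong β {α} {α′} eq = begin
  sum (β ++ α)    ≡⟨ sum-++ β α ⟩
  sum β + sum α   ≡⟨ ≡.cong (sum β +_) eq ⟩
  sum β + sum α′  ≡⟨ sum-++ β α′ ⟨
  sum (β ++ α′)   ∎
  where open ≡.≡-Reasoning

sum-swap : ∀ β {k j} δ → sum (β ++ j ∷ k ∷ δ) ≡ sum (β ++ k ∷ j ∷ δ)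
sum-swap β {k} {j} δ = sum-++-cong β (+-left-comm j k (sum δ))

sum-merge : ∀ β {k j} δ → sum (β ++ (k + j) ∷ δ) ≡ sum (β ++ k ∷ j ∷ δ)
sum-merge β {k} {j} δ = sum-++-cong β (ℕ.+-assoc k j (sum δ))

positionWeight-++-< : ∀ β {α α′} → sum α ≡ sum α′ → positionWeight α < positionWeight α′ →
                      positionWeight (β ++ α) < positionWeight (β ++ α′)
positionWeight-++-< []      _  lt = lt
positionWeight-++-< (_ ∷ β) {α} {α′} eq lt = begin-strict
  sum (β ++ α)  + positionWeight (β ++ α)   ≡⟨ ≡.cong (_+ positionWeight (β ++ α)) (sum-++-cong β eq) ⟩
  sum (β ++ α′) + positionWeight (β ++ α)   <⟨ ℕ.+-monoʳ-< (sum (β ++ α′)) (positionWeight-++-< β eq lt) ⟩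
  sum (β ++ α′) + positionWeight (β ++ α′)  ∎
  where open ℕ.≤-Reasoning

positionWeight-swap : ∀ β {k j} δ → k < j →
                      positionWeight (β ++ j ∷ k ∷ δ) < positionWeight (β ++ k ∷ j ∷ δ)
positionWeight-swap β {k} {j} δ k<j = positionWeight-++-< β (+-left-comm j k (sum δ))
  (ℕ.+-monoˡ-< (sum δ + positionWeight δ) (ℕ.+-monoˡ-< (sum δ) k<j))

positionWeight-merge : ∀ β {k j} δ → 1 ≤ j →
                       positionWeight (β ++ (k + j) ∷ δ) < positionWeight (β ++ k ∷ j ∷ δ)
positionWeight-merge β {k} {j} δ 1≤j = positionWeight-++-< β (ℕ.+-assoc k j (sum δ))
  (ℕ.m<n+m (sum δ + positionWeight δ) (ℕ.≤-trans 1≤j (ℕ.m≤m+n j (sum δ))))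

IsComposition-swap : ∀ {d} β {k j} δ →
                     IsComposition d (β ++ k ∷ j ∷ δ) → IsComposition d (β ++ j ∷ k ∷ δ)
IsComposition-swap β δ (positive , total) with All.++⁻ β positive
... | pβ , pk ∷ pj ∷ pδ = All.++⁺ pβ (pj ∷ pk ∷ pδ) , ≡.trans (sum-swap β δ) total

IsComposition-merge : ∀ {d} β {k j} δ →
                      IsComposition d (β ++ k ∷ j ∷ δ) → IsComposition d (β ++ (k + j) ∷ δ)
IsComposition-merge β {k} {j} δ (positive , total) with All.++⁻ β positive
... | pβ , pk ∷ _ ∷ pδ = All.++⁺ pβ (ℕ.≤-trans pk (ℕ.m≤m+n k j) ∷ pδ) , ≡.trans (sum-merge β δ) total

IsComposition-adjacent : ∀ {d} β {k j} δ → IsComposition d (β ++ k ∷ j ∷ δ) → 1 ≤ k × 1 ≤ j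
IsComposition-adjacent β δ (positive , _) with All.++⁻ β positive
... | _ , pk ∷ pj ∷ _ = pk , pj

updateAt-cancel : ∀ {A : Set} {m} (i : Fin m) {f g : A → A} (xs : Vec A m) →
                  g (f (lookup xs i)) ≡ lookup xs i → updateAt (updateAt xs i f) i g ≡ xs
updateAt-cancel i xs eq = ≡.trans (Vec.updateAt-updateAt-local i {h = λ x → x} xs eq) (Vec.updateAt-id i xs)

updateAt-pred-fibre : ∀ {m} (i : Fin m) {e : Vec ℕ m} f →
                      updateAt f i (_∸ 1) ≡ e → f ≢ updateAt e i suc → lookup f i ≡ 0
updateAt-pred-fibre i f ≡.refl f≢ with lookup f i in fᵢ
... | zero  = ≡.refl
... | suc _ = contradiction
  (≡.sym (updateAt-cancel i f (≡.trans (≡.cong (λ x → suc (x ∸ 1)) fᵢ) (≡.sym fᵢ)))) f≢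

module LinearOperators {c ℓ : Level} (R : CommutativeRing c ℓ) (n : ℕ) where
  open CommutativeRing R renaming (Carrier to K; _+_ to _+ᴿ_)
  open Ops R n
  open import Algebra.Properties.Ring ring using (-1*x≈-x)
  open import Algebra.Properties.AbelianGroup +-abelianGroup using (xyx⁻¹≈y)
  open import Algebra.Properties.CommutativeSemigroup +-commutativeSemigroup using (interchange)
  open import Algebra.Properties.CommutativeSemigroup *-commutativeSemigroup using (x∙yz≈y∙xz)
  module K-Reasoning = Reasoning setoid

  infixr 7 _·_
  _·_ : K → Poly → Poly
  γ · p = (γ • idOp) p

  -- _≈P_ unfolds to a Π-type, from which Agda cannot infer the polynomials it relates; this wrapper can.
  infix 4 _≋_
  record _≋_ (p q : Poly) : Set ℓ where
    constructor coeffwise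
    field coeff-≈ : p ≈P q
  open _≋_

  Poly-setoid : Setoid c ℓ
  Poly-setoid = record
    { Carrier       = Poly
    ; _≈_           = _≋_
    ; isEquivalence = record
      { refl  = coeffwise λ _ → refl
      ; sym   = λ p≋q → coeffwise λ e → sym (coeff-≈ p≋q e)
      ; trans = λ p≋q q≋r → coeffwise λ e → trans (coeff-≈ p≋q e) (coeff-≈ q≋r e)
      }
    }

  open Setoid Poly-setoid using ()
    renaming (refl to ≋-refl; sym to ≋-sym; trans to ≋-trans; reflexive to ≡⇒≋)
  module ≋-Reasoning = Reasoning Poly-setoid

  coeff-++ : ∀ p q e → coeff (p ++ q) e ≈ coeff p e +ᴿ coeff q e
  coeff-++ []            q e = sym (+-identityˡ _)
  coeff-++ ((a , f) ∷ p) q e with Vec.≡-dec ℕ._≟_ f e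
  ... | yes _ = trans (+-cong refl (coeff-++ p q e)) (sym (+-assoc _ _ _))
  ... | no _  = coeff-++ p q e

  coeff-· : ∀ γ p e → coeff (γ · p) e ≈ γ * coeff p e
  coeff-· γ []            e = sym (zeroʳ _)
  coeff-· γ ((a , f) ∷ p) e with Vec.≡-dec ℕ._≟_ f e
  ... | yes _ = trans (+-cong refl (coeff-· γ p e)) (sym (distribˡ _ _ _))
  ... | no _  = coeff-· γ p e

  ∷-cong : ∀ f {a b p q} → a ≈ b → p ≋ q → (a , f) ∷ p ≋ (b , f) ∷ q
  ∷-cong f {a} {b} {p} {q} a≈b p≋q = coeffwise coeff-∷
    where
    coeff-∷ : ∀ e → coeff ((a , f) ∷ p) e ≈ coeff ((b , f) ∷ q) e
    coeff-∷ e with Vec.≡-dec ℕ._≟_ f e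
    ... | yes _ = +-cong a≈b (coeff-≈ p≋q e)
    ... | no _  = coeff-≈ p≋q e

  ++-cong : ∀ {p p′ q q′} → p ≋ p′ → q ≋ q′ → p ++ q ≋ p′ ++ q′
  ++-cong {p} {p′} {q} {q′} p≋p′ q≋q′ = coeffwise λ e →
    trans (coeff-++ p q e) (trans (+-cong (coeff-≈ p≋p′ e) (coeff-≈ q≋q′ e)) (sym (coeff-++ p′ q′ e)))

  ·-cong : ∀ γ {p q} → p ≋ q → γ · p ≋ γ · q
  ·-cong γ {p} {q} p≋q = coeffwise λ e →
    trans (coeff-· γ p e) (trans (*-cong refl (coeff-≈ p≋q e)) (sym (coeff-· γ q e)))

  ·-++ : ∀ γ p q → γ · (p ++ q) ≡ γ · p ++ γ · q
  ·-++ γ = List.map-++ _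

  ·-identityˡ : ∀ p → 1# · p ≋ p
  ·-identityˡ p = coeffwise λ e → trans (coeff-· 1# p e) (*-identityˡ _)

  *-· : ∀ γ δ p → (γ * δ) · p ≋ γ · δ · p
  *-· γ δ p = coeffwise λ e → begin
    coeff ((γ * δ) · p) e  ≈⟨ coeff-· (γ * δ) p e ⟩
    (γ * δ) * coeff p e    ≈⟨ *-assoc γ δ _ ⟩
    γ * (δ * coeff p e)    ≈⟨ *-cong refl (coeff-· δ p e) ⟨
    γ * coeff (δ · p) e    ≈⟨ coeff-· γ (δ · p) e ⟨
    coeff (γ · δ · p) e    ∎
    where open K-Reasoning

  ·-·-comm : ∀ γ δ p → γ · δ · p ≋ δ · γ · p
  ·-·-comm γ δ p = coeffwise λ e → begin
    coeff (γ · δ · p) e  ≈⟨ trans (coeff-· γ (δ · p) e) (*-cong refl (coeff-· δ p e)) ⟩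
    γ * (δ * coeff p e)  ≈⟨ x∙yz≈y∙xz γ δ _ ⟩
    δ * (γ * coeff p e)  ≈⟨ trans (coeff-· δ (γ · p) e) (*-cong refl (coeff-· γ p e)) ⟨
    coeff (δ · γ · p) e  ∎
    where open K-Reasoning

  ++-interchange : ∀ p q r s → (p ++ q) ++ (r ++ s) ≋ (p ++ r) ++ (q ++ s)
  ++-interchange p q r s = coeffwise λ e → begin
    coeff ((p ++ q) ++ (r ++ s)) e
      ≈⟨ trans (coeff-++ (p ++ q) (r ++ s) e) (+-cong (coeff-++ p q e) (coeff-++ r s e)) ⟩
    (coeff p e +ᴿ coeff q e) +ᴿ (coeff r e +ᴿ coeff s e)
      ≈⟨ interchange _ _ _ _ ⟩
    (coeff p e +ᴿ coeff r e) +ᴿ (coeff q e +ᴿ coeff s e)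
      ≈⟨ trans (coeff-++ (p ++ r) (q ++ s) e) (+-cong (coeff-++ p r e) (coeff-++ q s e)) ⟨
    coeff ((p ++ r) ++ (q ++ s)) e
      ∎
    where open K-Reasoning

  record IsLinear (T : Op) : Set (c ⊔ ℓ) where
    field
      cong    : ∀ {p q} → p ≋ q → T p ≋ T q
      ++-homo : ∀ p q → T (p ++ q) ≋ T p ++ T q
      ·-homo  : ∀ γ p → T (γ · p) ≋ γ · T p

  open IsLinear

  idOp-isLinear : IsLinear idOp
  idOp-isLinear = record
    { cong = λ p≋q → p≋q ; ++-homo = λ _ _ → ≋-refl ; ·-homo = λ _ _ → ≋-refl }

  zeroOp-isLinear : IsLinear zeroOp
  zeroOp-isLinear = record
    { cong = λ _ → ≋-refl ; ++-homo = λ _ _ → ≋-refl ; ·-homo = λ _ _ → ≋-refl }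

  ∘Op-isLinear : ∀ {S T} → IsLinear S → IsLinear T → IsLinear (S ∘Op T)
  ∘Op-isLinear S-linear T-linear = record
    { cong    = cong S-linear ∘ cong T-linear
    ; ++-homo = λ p q → ≋-trans (cong S-linear (++-homo T-linear p q)) (++-homo S-linear _ _)
    ; ·-homo  = λ γ p → ≋-trans (cong S-linear (·-homo T-linear γ p)) (·-homo S-linear γ _)
    }

  ⊕-isLinear : ∀ {S T} → IsLinear S → IsLinear T → IsLinear (S ⊕ T)
  ⊕-isLinear {S} {T} S-linear T-linear = record
    { cong    = λ p≋q → ++-cong (cong S-linear p≋q) (cong T-linear p≋q)
    ; ++-homo = λ p q → ≋-trans (++-cong (++-homo S-linear p q) (++-homo T-linear p q))
                                (++-interchange (S p) (S q) (T p) (T q))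
    ; ·-homo  = λ γ p → ≋-trans (++-cong (·-homo S-linear γ p) (·-homo T-linear γ p))
                                (≡⇒≋ (≡.sym (·-++ γ (S p) (T p))))
    }

  •-isLinear : ∀ δ {T} → IsLinear T → IsLinear (δ • T)
  •-isLinear δ {T} T-linear = record
    { cong    = ·-cong δ ∘ cong T-linear
    ; ++-homo = λ p q → ≋-trans (·-cong δ (++-homo T-linear p q)) (≡⇒≋ (·-++ δ (T p) (T q)))
    ; ·-homo  = λ γ p → ≋-trans (·-cong δ (·-homo T-linear γ p)) (·-·-comm δ γ _)
    }

  ΣOp-isLinear : ∀ {Ts} → All IsLinear Ts → IsLinear (ΣOp Ts)
  ΣOp-isLinear []                   = zeroOp-isLinear
  ΣOp-isLinear (T-linear ∷ Ts-linear) = ⊕-isLinear T-linear (ΣOp-isLinear Ts-linear)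

  relabel : (Mon → Mon) → Op
  relabel h = map (λ t → proj₁ t , h (proj₂ t))

  coeff-relabel : ∀ h {e e′} → (∀ f → h f ≡ e ⇔ f ≡ e′) → ∀ p → coeff (relabel h p) e ≈ coeff p e′
  coeff-relabel h fibre [] = refl
  coeff-relabel h {e} {e′} fibre ((a , f) ∷ p) with Vec.≡-dec ℕ._≟_ (h f) e | Vec.≡-dec ℕ._≟_ f e′
  ... | yes _    | yes _    = +-cong refl (coeff-relabel h fibre p)
  ... | no _     | no _     = coeff-relabel h fibre p
  ... | yes hf≡e | no f≢e′  = contradiction (Equivalence.to (fibre f) hf≡e) f≢e′
  ... | no hf≢e  | yes f≡e′ = contradiction (Equivalence.from (fibre f) f≡e′) hf≢e

  coeff-relabel-∉ : ∀ h {e} → (∀ f → h f ≢ e) → ∀ p → coeff (relabel h p) e ≈ 0#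
  coeff-relabel-∉ h ∉h [] = refl
  coeff-relabel-∉ h {e} ∉h ((a , f) ∷ p) with Vec.≡-dec ℕ._≟_ (h f) e
  ... | yes hf≡e = contradiction hf≡e (∉h f)
  ... | no _     = coeff-relabel-∉ h ∉h p

  relabel-isLinear : ∀ h → (∀ e → (Σ[ e′ ∈ Mon ] ∀ f → h f ≡ e ⇔ f ≡ e′) ⊎ (∀ f → h f ≢ e)) →
                     IsLinear (relabel h)
  relabel-isLinear h fibres = record
    { cong    = λ {p} {q} p≋q → coeffwise λ e → relabel-cong p q p≋q e (fibres e)
    ; ++-homo = λ p q → ≡⇒≋ (List.map-++ _ p q)
    ; ·-homo  = λ γ p → ≡⇒≋ (≡.trans (≡.sym (List.map-∘ p)) (List.map-∘ p))
    }
    where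
    relabel-cong : ∀ p q → p ≋ q → ∀ e → (Σ[ e′ ∈ Mon ] ∀ f → h f ≡ e ⇔ f ≡ e′) ⊎ (∀ f → h f ≢ e) →
                   coeff (relabel h p) e ≈ coeff (relabel h q) e
    relabel-cong p q p≋q e (inj₁ (e′ , fibre)) =
      trans (coeff-relabel h fibre p) (trans (coeff-≈ p≋q e′) (sym (coeff-relabel h fibre q)))
    relabel-cong p q p≋q e (inj₂ ∉h) =
      trans (coeff-relabel-∉ h ∉h p) (sym (coeff-relabel-∉ h ∉h q))

  mulX-isLinear : ∀ i k → IsLinear (mulX i k)
  mulX-isLinear i k = relabel-isLinear (λ f → updateAt f i (_+ k)) shift-fibre
    where
    shift-fibre : ∀ e → (Σ[ e′ ∈ Mon ] ∀ f → updateAt f i (_+ k) ≡ e ⇔ f ≡ e′)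
                        ⊎ (∀ f → updateAt f i (_+ k) ≢ e)
    shift-fibre e with k ≤? lookup e i
    ... | yes k≤eᵢ = inj₁ (updateAt e i (_∸ k) , λ f → mk⇔
          (λ { ≡.refl → ≡.sym (updateAt-cancel i f (ℕ.m+n∸n≡m (lookup f i) k)) })
          (λ { ≡.refl → updateAt-cancel i e (ℕ.m∸n+n≡m k≤eᵢ) }))
    ... | no k≰eᵢ = inj₂ λ f shifted → k≰eᵢ (≡.subst (k ≤_)
          (≡.trans (≡.sym (Vec.lookup∘updateAt i f)) (≡.cong (λ v → lookup v i) shifted))
          (ℕ.m≤n+m k (lookup f i)))

  coeff-∂ : ∀ i p e → coeff (∂ i p) e ≈ coeff p (updateAt e i suc) * fromℕ (suc (lookup e i))
  coeff-∂ i [] e = sym (zeroˡ _)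
  coeff-∂ i ((a , f) ∷ p) e
    with Vec.≡-dec ℕ._≟_ (updateAt f i (_∸ 1)) e | Vec.≡-dec ℕ._≟_ f (updateAt e i suc)
  ... | yes _ | yes ≡.refl = begin
    a * fromℕ (lookup (updateAt e i suc) i) +ᴿ coeff (∂ i p) e
      ≈⟨ +-cong (*-cong refl (reflexive (≡.cong fromℕ (Vec.lookup∘updateAt i e)))) (coeff-∂ i p e) ⟩
    a * fromℕ (suc (lookup e i)) +ᴿ coeff p (updateAt e i suc) * fromℕ (suc (lookup e i))
      ≈⟨ distribʳ _ _ _ ⟨
    (a +ᴿ coeff p (updateAt e i suc)) * fromℕ (suc (lookup e i))
      ∎
    where open K-Reasoning
  ... | yes lowered | no f≢ = begin
    a * fromℕ (lookup f i) +ᴿ coeff (∂ i p) e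
      ≈⟨ +-cong (*-cong refl (reflexive (≡.cong fromℕ (updateAt-pred-fibre i f lowered f≢)))) (coeff-∂ i p e) ⟩
    a * 0# +ᴿ coeff p (updateAt e i suc) * fromℕ (suc (lookup e i))
      ≈⟨ trans (+-cong (zeroʳ a) refl) (+-identityˡ _) ⟩
    coeff p (updateAt e i suc) * fromℕ (suc (lookup e i))
      ∎
    where open K-Reasoning
  ... | no not-lowered | yes ≡.refl = contradiction (updateAt-cancel i e ≡.refl) not-lowered
  ... | no _ | no _ = coeff-∂ i p e

  ∂-isLinear : ∀ i → IsLinear (∂ i)
  ∂-isLinear i = record
    { cong    = λ {p} {q} p≋q → coeffwise λ e →
                  trans (coeff-∂ i p e) (trans (*-cong (coeff-≈ p≋q _) refl) (sym (coeff-∂ i q e)))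
    ; ++-homo = λ p q → ≡⇒≋ (List.map-++ _ p q)
    ; ·-homo  = ∂-·-homo
    }
    where
    ∂-·-homo : ∀ γ p → ∂ i (γ · p) ≋ γ · ∂ i p
    ∂-·-homo γ []            = ≋-refl
    ∂-·-homo γ ((a , f) ∷ p) = ∷-cong (updateAt f i (_∸ 1)) (*-assoc γ a _) (∂-·-homo γ p)

  commutator-rearrange : ∀ {S T U γ} → [ S , T ] ≈Op (γ • U) → ∀ p → S (T p) ≋ T (S p) ++ γ · U p
  commutator-rearrange {S} {T} {U} {γ} [S,T]≈γU p = coeffwise rearranged
    where
    open K-Reasoning
    rearranged : ∀ e → coeff (S (T p)) e ≈ coeff (T (S p) ++ γ · U p) e
    rearranged e = let x = coeff (S (T p)) e ; y = coeff (T (S p)) e in begin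
      x                            ≈⟨ xyx⁻¹≈y y x ⟨
      y +ᴿ x +ᴿ - y                ≈⟨ +-assoc y x (- y) ⟩
      y +ᴿ (x +ᴿ - y)              ≈⟨ +-cong refl (+-cong refl (-1*x≈-x y)) ⟨
      y +ᴿ (x +ᴿ (- 1#) * y)       ≈⟨ +-cong refl commutator-coeff ⟨
      y +ᴿ coeff ([ S , T ] p) e   ≈⟨ +-cong refl ([S,T]≈γU p e) ⟩
      y +ᴿ coeff (γ · U p) e       ≈⟨ coeff-++ (T (S p)) (γ · U p) e ⟨
      coeff (T (S p) ++ γ · U p) e ∎
      where
      commutator-coeff : coeff ([ S , T ] p) e ≈ coeff (S (T p)) e +ᴿ (- 1#) * coeff (T (S p)) e
      commutator-coeff = trans (coeff-++ (S (T p)) _ e) (+-cong refl (coeff-· (- 1#) (T (S p)) e))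

  module _ (a b : ℕ → Fin n → K) where

    Dstar-isLinear : ∀ k → IsLinear (Dstar a b k)
    Dstar-isLinear k = ΣOp-isLinear (All.map⁺ (All.universal summand-isLinear (allFin n)))
      where
      summand-isLinear : ∀ i → IsLinear ((a k i • (mulX i (suc k) ∘Op ∂ i)) ⊕ (b k i • mulX i k))
      summand-isLinear i =
        ⊕-isLinear (•-isLinear (a k i) (∘Op-isLinear (mulX-isLinear i (suc k)) (∂-isLinear i)))
                   (•-isLinear (b k i) (mulX-isLinear i k))

    DstarSeq-isLinear : ∀ α → IsLinear (DstarSeq a b α)
    DstarSeq-isLinear []      = idOp-isLinear
    DstarSeq-isLinear (k ∷ α) = ∘Op-isLinear (Dstar-isLinear k) (DstarSeq-isLinear α)

    DstarSeq-++ : ∀ β α p → DstarSeq a b (β ++ α) p ≡ DstarSeq a b β (DstarSeq a b α p)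
    DstarSeq-++ []      α p = ≡.refl
    DstarSeq-++ (k ∷ β) α p = ≡.cong (Dstar a b k) (DstarSeq-++ β α p)

    DstarSeq-straighten : ∀ β {k j} δ {γ} → [ Dstar a b k , Dstar a b j ] ≈Op (γ • Dstar a b (k + j)) →
      DstarSeq a b (β ++ k ∷ j ∷ δ) ≈Op
        (DstarSeq a b (β ++ j ∷ k ∷ δ) ⊕ (γ • DstarSeq a b (β ++ (k + j) ∷ δ)))
    DstarSeq-straighten β {k} {j} δ {γ} commutes p = coeff-≈ (begin
      DS (β ++ k ∷ j ∷ δ) p                      ≡⟨ DstarSeq-++ β (k ∷ j ∷ δ) p ⟩
      DS β (D k (D j q))
        ≈⟨ cong β-linear (commutator-rearrange {D k} {D j} {D (k + j)} commutes q) ⟩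
      DS β (D j (D k q) ++ γ · D (k + j) q)      ≈⟨ ++-homo β-linear _ _ ⟩
      DS β (D j (D k q)) ++ DS β (γ · D (k + j) q) ≈⟨ ++-cong ≋-refl (·-homo β-linear γ _) ⟩
      DS β (D j (D k q)) ++ γ · DS β (D (k + j) q)
        ≡⟨ ≡.cong₂ (λ u v → u ++ γ · v) (DstarSeq-++ β (j ∷ k ∷ δ) p) (DstarSeq-++ β ((k + j) ∷ δ) p) ⟨
      DS (β ++ j ∷ k ∷ δ) p ++ γ · DS (β ++ (k + j) ∷ δ) p ∎)
      where
      open ≋-Reasoning
      D = Dstar a b
      DS = DstarSeq a b
      q = DS δ p
      β-linear = DstarSeq-isLinear β

    Combination : Set c
    Combination = List (K × List ℕ)

    combination : Combination → Op
    combination cs = ΣOp (map (λ t → proj₁ t • DstarSeq a b (proj₂ t)) cs)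

    combination-++ : ∀ cs ds p → combination (cs ++ ds) p ≡ combination cs p ++ combination ds p
    combination-++ []       ds p = ≡.refl
    combination-++ ((γ , α) ∷ cs) ds p =
      ≡.trans (≡.cong (γ · DstarSeq a b α p ++_) (combination-++ cs ds p))
              (≡.sym (List.++-assoc (γ · DstarSeq a b α p) (combination cs p) (combination ds p)))

    scaleBy : K → Combination → Combination
    scaleBy γ = map (λ t → γ * proj₁ t , proj₂ t)

    combination-scaleBy : ∀ γ cs p → combination (scaleBy γ cs) p ≋ γ · combination cs p
    combination-scaleBy γ []             p = ≋-refl
    combination-scaleBy γ ((δ , α) ∷ cs) p = begin
      (γ * δ) · DstarSeq a b α p ++ combination (scaleBy γ cs) p
        ≈⟨ ++-cong (*-· γ δ _) (combination-scaleBy γ cs p) ⟩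
      γ · δ · DstarSeq a b α p ++ γ · combination cs p
        ≡⟨ ·-++ γ (δ · DstarSeq a b α p) (combination cs p) ⟨
      γ · (δ · DstarSeq a b α p ++ combination cs p)
        ∎
      where open ≋-Reasoning

    module _ {P : List ℕ → Set} where

      InSpan-resp : ∀ {S T} → S ≈Op T → InSpan a b P S → InSpan a b P T
      InSpan-resp S≈T (cs , P-cs , S≈cs) = cs , P-cs , λ p e → trans (sym (S≈T p e)) (S≈cs p e)

      InSpan-zeroOp : InSpan a b P zeroOp
      InSpan-zeroOp = [] , [] , λ _ _ → refl

      InSpan-⊕ : ∀ {S T} → InSpan a b P S → InSpan a b P T → InSpan a b P (S ⊕ T)
      InSpan-⊕ {S} {T} (cs , P-cs , S≈cs) (ds , P-ds , T≈ds) =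
        cs ++ ds , All.++⁺ P-cs P-ds , λ p → coeff-≈ (≋-trans
          (++-cong (coeffwise {S p} {combination cs p} (S≈cs p)) (coeffwise {T p} {combination ds p} (T≈ds p)))
          (≡⇒≋ (≡.sym (combination-++ cs ds p))))

      InSpan-• : ∀ γ {T} → InSpan a b P T → InSpan a b P (γ • T)
      InSpan-• γ {T} (cs , P-cs , T≈cs) =
        scaleBy γ cs , All.map⁺ P-cs , λ p → coeff-≈ (≋-trans
          (·-cong γ (coeffwise {T p} {combination cs p} (T≈cs p)))
          (≋-sym (combination-scaleBy γ cs p)))

      DstarSeq-inSpan : ∀ {α} → P α → InSpan a b P (DstarSeq a b α)
      DstarSeq-inSpan {α} Pα = (1# , α) ∷ [] , Pα ∷ [] , λ p → coeff-≈
        (≋-trans (≋-sym (·-identityˡ (DstarSeq a b α p))) (≡⇒≋ (≡.sym (List.++-identityʳ _))))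

    InSpan-⊆ : ∀ {P Q T} → (∀ {α} → P α → InSpan a b Q (DstarSeq a b α)) →
               InSpan a b P T → InSpan a b Q T
    InSpan-⊆ {P} {Q} {T} P⇒Q (cs , P-cs , T≈cs) =
      InSpan-resp {S = combination cs} {T} (λ p e → sym (T≈cs p e)) (combination-inSpan P-cs)
      where
      combination-inSpan : ∀ {cs} → All (P ∘ proj₂) cs → InSpan a b Q (combination cs)
      combination-inSpan []           = InSpan-zeroOp
      combination-inSpan {(γ , α) ∷ cs} (Pα ∷ P-cs) =
        InSpan-⊕ {S = γ • DstarSeq a b α} {combination cs}
          (InSpan-• γ {DstarSeq a b α} (P⇒Q Pα)) (combination-inSpan P-cs)

    CommutatorsClose : Set (c ⊔ ℓ)
    CommutatorsClose = ∀ k j → 1 ≤ k → 1 ≤ j →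
      Σ K λ γ → [ Dstar a b k , Dstar a b j ] ≈Op (γ • Dstar a b (k + j))

    DstarSeq-inPartitionSpan : CommutatorsClose → ∀ {d} α → IsComposition d α →
                               InSpan a b (IsPartition d) (DstarSeq a b α)
    DstarSeq-inPartitionSpan closed {d} α = straighten α (<-wellFounded (positionWeight α))
      where
      straighten : ∀ α → Acc _<_ (positionWeight α) → IsComposition d α →
                   InSpan a b (IsPartition d) (DstarSeq a b α)
      straighten α (acc smaller) α-comp with weaklyDecreasing⊎ascent α
      ... | inj₁ decreasing = DstarSeq-inSpan (α-comp , decreasing)
      ... | inj₂ (ascent β k j δ k<j ≡.refl) =
        let (1≤k , 1≤j)    = IsComposition-adjacent β δ α-comp
            (γ , commutes) = closed k j 1≤k 1≤j
            swapped        = β ++ j ∷ k ∷ δ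
            merged         = β ++ (k + j) ∷ δ
        in InSpan-resp {S = DS swapped ⊕ (γ • DS merged)} {DS (β ++ k ∷ j ∷ δ)}
             (λ p e → sym (DstarSeq-straighten β δ commutes p e))
             (InSpan-⊕ {S = DS swapped} {γ • DS merged}
               (straighten swapped (smaller (positionWeight-swap β δ k<j)) (IsComposition-swap β δ α-comp))
               (InSpan-• γ {DS merged}
                 (straighten merged (smaller (positionWeight-merge β δ 1≤j)) (IsComposition-merge β δ α-comp))))
        where DS = DstarSeq a b

mainTheorem1 : {c ℓ : Level} (R : CommutativeRing c ℓ) (n : ℕ) → 1 ≤ n →
    (a b : ℕ → Fin n → CommutativeRing.Carrier R) →
    ((k j : ℕ) → 1 ≤ k → 1 ≤ j →
      Σ (CommutativeRing.Carrier R) λ γ →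
        Ops._≈Op_ R n (Ops.[_,_] R n (Ops.Dstar R n a b k) (Ops.Dstar R n a b j))
                      (Ops._•_ R n γ (Ops.Dstar R n a b (k + j)))) →
    (d : ℕ) → 1 ≤ d → (T : Ops.Op R n) →
      (Ops.InSpan R n a b (IsPartition d) T → Ops.InSpan R n a b (IsComposition d) T) ×
      (Ops.InSpan R n a b (IsComposition d) T → Ops.InSpan R n a b (IsPartition d) T)
mainTheorem1 R n _ a b closed d _ T =
  InSpan-⊆ a b {T = T} (DstarSeq-inSpan a b ∘ proj₁) ,
  InSpan-⊆ a b {T = T} (DstarSeq-inPartitionSpan a b closed _)
  where open LinearOperators R n
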